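{- For integers $r$, $n\ge0$ and $i$, let $u_r(n)$ be the number of permutations of $[n]$ with exactly $r$ occurrences of the pattern $12\text{ - }3$, and $u_r(n;i)$ the number of such permutations $a_1\cdots a_n$ with $a_1=i$; set $u_r(n)=u_r(n;i)=0$ when $r<0$. Let $n\ge1$. Then $u_r(n;n)=u_r(n-1)$; if $n\ge2$ then also $u_r(n;n-1)=u_r(n-1)$; and for every $1\le i\le n-2$, $$u_r(n;i)=\sum_{j=1}^{i-1}u_r(n-1;j)+\sum_{j=0}^{n-i-1}u_{r-j}(n-1;n-1-j).$$
   Context: An occurrence of the pattern $12\text{ - }3$ in a permutation $a_1a_2\cdots a_n$ is a pair of indices $(i,j)$ with $i+1<j\le n$ such that $a_i<a_{i+1}<a_j$. The empty permutation has no occurrences. -}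

module Defs where

open import Data.Nat using (ℕ; zero; suc; _+_; _∸_; _<?_)
open import Data.Integer using (ℤ; +_; -[1+_]; _-_)
open import Data.List using (List; []; _∷_; map; concatMap; length; filter; upTo; head)
open import Data.Nat.ListAction using (sum)
open import Data.Maybe using (just)
open import Relation.Nullary.Decidable using (does)
open import Data.Bool using (if_then_else_)
open import Data.Maybe.Properties using () renaming (≡-dec to maybe-≡-dec)
open import Data.Nat.Properties using (_≟_)

insertions : ℕ → List ℕ → List (List ℕ)
insertions x [] = (x ∷ []) ∷ []
insertions x (y ∷ ys) = (x ∷ y ∷ ys) ∷ map (y ∷_) (insertions x ys)

-- perms n : the list of all n! permutations of [n] = {1,…,n},
-- each written in one-line notation a₁ a₂ ⋯ aₙ (each occurs exactly once)
perms : ℕ → List (List ℕ)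
perms zero = [] ∷ []
perms (suc n) = concatMap (insertions (suc n)) (perms n)

countAbove : ℕ → List ℕ → ℕ
countAbove y zs = length (filter (y <?_) zs)

-- number of occurrences of the pattern 12-3 in a₁⋯aₙ: pairs (i,j) with
-- i+1 < j ≤ n and aᵢ < aᵢ₊₁ < aⱼ
occ123 : List ℕ → ℕ
occ123 [] = 0
occ123 (x ∷ []) = 0
occ123 (x ∷ y ∷ rest) =
  (if does (x <? y) then countAbove y rest else 0) + occ123 (y ∷ rest)

uℕ : ℕ → ℕ → ℕ
uℕ r n = length (filter (λ a → occ123 a ≟ r) (perms n))

uℕ-first : ℕ → ℕ → ℕ → ℕ
uℕ-first r n i =
  length (filter (λ a → maybe-≡-dec _≟_ (head a) (just i)) (filter (λ a → occ123 a ≟ r) (perms n)))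

u : ℤ → ℕ → ℕ
u (+ r) n = uℕ r n
u -[1+ _ ] n = 0

u′ : ℤ → ℕ → ℕ → ℕ
u′ (+ r) n i = uℕ-first r n i
u′ -[1+ _ ] n i = 0

-- Σ_{j=a}^{b} f j   (0 if b < a)
sumFromTo : ℕ → ℕ → (ℕ → ℕ) → ℕ
sumFromTo a b f = sum (map (λ k → f (a + k)) (upTo (suc b ∸ a)))

module Submission where

-- Deleting the first entry of a permutation of [n] and standardising the rest is a bijection onto
-- the permutations of [n-1] which keeps every occurrence of 12-3 not starting at position 1.
-- An occurrence starting there needs a₁ < a₂ and is then completed by each later entry above a₂,
-- so a permutation with a₁ = i < a₂ = n - j has exactly j more occurrences than its standardised
-- tail, and one with a₂ < i has none. Grouping the permutations with a₁ = i by a₂ gives the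
-- recurrence; for i ≥ n - 1 no occurrence can start at position 1.

open import Defs
open import Data.Bool using (true; false; if_then_else_)
open import Data.Empty using (⊥-elim)
open import Data.Integer as ℤ using (ℤ; +_; -[1+_]; _-_)
import Data.Integer.Properties as ℤₚ
open import Data.Integer.Tactic.RingSolver using (solve-∀)
open import Data.List using (List; []; _∷_; _++_; map; concatMap; length; filter; applyUpTo; applyDownFrom; head)
open import Data.List.Properties using (map-cong; map-cong-local; map-id-local; map-++; map-∘; map-upTo)
open import Data.List.Relation.Unary.All as All using (All; []; _∷_)
open import Data.List.Relation.Unary.All.Properties using (applyDownFrom⁺₁; concat⁺; map⁺)
open import Data.List.Relation.Binary.Permutation.Propositional as ↭ using (_↭_; ↭-sym)
open import Data.List.Relation.Binary.Permutation.Propositional.Properties using (All-resp-↭; ↭-length; filter-↭)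
open import Data.Maybe using (just)
open import Data.Maybe.Properties using (just-injective) renaming (≡-dec to maybe-≡-dec)
open import Data.Nat using (ℕ; zero; suc; _+_; _*_; _∸_; _≤_; _<_; _≥_; z≤n; s≤s; _<?_; _≤?_)
open import Data.Nat.ListAction using (sum)
open import Data.Nat.ListAction.Properties using (sum-++)
open import Data.Nat.Properties
open import Algebra.Properties.CommutativeSemigroup +-commutativeSemigroup using (interchange)
open import Data.Product using (_×_; _,_)
open import Function using (_∘_; _⇔_; mk⇔)
open import Relation.Binary.PropositionalEquality using (_≡_; _≢_; refl; sym; trans; cong; cong₂; subst; module ≡-Reasoning)
open import Relation.Binary.Definitions using (tri<; tri≈; tri>)
open import Relation.Nullary using (Dec; yes; no; does; ¬_)
open import Relation.Nullary.Decidable using (dec-true; dec-false; does-⇔)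

χ : {A : Set} → Dec A → ℕ
χ d = if does d then 1 else 0

χ-yes : {A : Set} (d : Dec A) → A → χ d ≡ 1
χ-yes d a rewrite dec-true d a = refl

χ-no : {A : Set} (d : Dec A) → ¬ A → χ d ≡ 0
χ-no d ¬a rewrite dec-false d ¬a = refl

χ-⇔ : {A B : Set} → A ⇔ B → (d : Dec A) (e : Dec B) → χ d ≡ χ e
χ-⇔ A⇔B d e = cong (λ b → if b then 1 else 0) (does-⇔ A⇔B d e)

∑< : ℕ → (ℕ → ℕ) → ℕ
∑< zero    F = 0
∑< (suc m) F = F 0 + ∑< m (F ∘ suc)

syntax ∑< m (λ k → e) = ∑[ k < m ] e

∑<-cong : ∀ m {F G : ℕ → ℕ} → (∀ {k} → k < m → F k ≡ G k) → ∑< m F ≡ ∑< m G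
∑<-cong zero    eq = refl
∑<-cong (suc m) eq = cong₂ _+_ (eq (s≤s z≤n)) (∑<-cong m (eq ∘ s≤s))

∑<-zero : ∀ m {F : ℕ → ℕ} → (∀ {k} → k < m → F k ≡ 0) → ∑< m F ≡ 0
∑<-zero zero    eq = refl
∑<-zero (suc m) eq rewrite eq (s≤s z≤n) = ∑<-zero m (eq ∘ s≤s)

∑<-single : ∀ m {c} {F : ℕ → ℕ} → c < m → (∀ {k} → k < m → k ≢ c → F k ≡ 0) → ∑< m F ≡ F c
∑<-single (suc m) {zero}  {F} _          eq =
  trans (cong (_+_ (F 0)) (∑<-zero m (λ k<m → eq (s≤s k<m) λ ()))) (+-identityʳ (F 0))
∑<-single (suc m) {suc c} {F} (s≤s c<m) eq rewrite eq (s≤s z≤n) (λ ()) =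
  ∑<-single m c<m (λ k<m k≢c → eq (s≤s k<m) (k≢c ∘ suc-injective))

∑<-+ : ∀ m (F G : ℕ → ℕ) → ∑[ k < m ] (F k + G k) ≡ ∑< m F + ∑< m G
∑<-+ zero    F G = refl
∑<-+ (suc m) F G =
  trans (cong (_+_ (F 0 + G 0)) (∑<-+ m (F ∘ suc) (G ∘ suc))) (interchange (F 0) (G 0) _ _)

∑<-last : ∀ m (F : ℕ → ℕ) → ∑< (suc m) F ≡ ∑< m F + F m
∑<-last zero    F = +-identityʳ (F 0)
∑<-last (suc m) F = trans (cong (_+_ (F 0)) (∑<-last m (F ∘ suc))) (sym (+-assoc (F 0) _ _))

∑<-split : ∀ a b (F : ℕ → ℕ) → ∑< (a + b) F ≡ ∑< a F + ∑[ j < b ] F (a + j)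
∑<-split zero    b F = refl
∑<-split (suc a) b F = trans (cong (_+_ (F 0)) (∑<-split a b (F ∘ suc))) (sym (+-assoc (F 0) _ _))

∑<-reverse : ∀ m (F : ℕ → ℕ) → ∑< m F ≡ ∑[ j < m ] F (m ∸ suc j)
∑<-reverse zero    F = refl
∑<-reverse (suc m) F = begin
  F 0 + ∑< m (F ∘ suc)                  ≡⟨ cong (_+_ (F 0)) (∑<-reverse m (F ∘ suc)) ⟩
  F 0 + ∑[ j < m ] F (suc (m ∸ suc j))  ≡⟨ cong (_+_ (F 0)) (∑<-cong m (cong F ∘ sym ∘ +-∸-assoc 1)) ⟩
  F 0 + ∑[ j < m ] F (m ∸ j)            ≡⟨ +-comm (F 0) _ ⟩
  ∑[ j < m ] F (m ∸ j) + F 0            ≡⟨ cong (λ x → ∑[ j < m ] F (m ∸ j) + F x) (n∸n≡0 m) ⟨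
  ∑[ j < m ] F (m ∸ j) + F (m ∸ m)      ≡⟨ ∑<-last m (λ j → F (m ∸ j)) ⟨
  ∑[ j < suc m ] F (m ∸ j)              ∎
  where open ≡-Reasoning

∑<-split-top : ∀ {c n} (F : ℕ → ℕ) → c ≤ n →
  ∑[ k < suc n ] F k ≡ ∑[ k < c ] F k + ∑[ j < suc (n ∸ c) ] F (n ∸ j)
∑<-split-top {c} {n} F c≤n = begin
  ∑< (suc n) F                                ≡⟨ cong (λ m → ∑< m F) length-split ⟨
  ∑< (c + suc (n ∸ c)) F                      ≡⟨ ∑<-split c _ F ⟩
  ∑< c F + ∑[ j < suc (n ∸ c) ] F (c + j)      ≡⟨ cong (_+_ (∑< c F)) (∑<-reverse (suc (n ∸ c)) (λ j → F (c + j))) ⟩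
  ∑< c F + ∑[ j < suc (n ∸ c) ] F (c + (n ∸ c ∸ j))
    ≡⟨ cong (_+_ (∑< c F)) (∑<-cong (suc (n ∸ c)) (λ { (s≤s j≤) → cong F (top j≤) })) ⟩
  ∑< c F + ∑[ j < suc (n ∸ c) ] F (n ∸ j)      ∎
  where
  open ≡-Reasoning
  length-split : c + suc (n ∸ c) ≡ suc n
  length-split = trans (+-suc c _) (cong suc (m+[n∸m]≡n c≤n))
  top : ∀ {j} → j ≤ n ∸ c → c + (n ∸ c ∸ j) ≡ n ∸ j
  top {j} j≤ = trans (sym (+-∸-assoc c j≤)) (cong (_∸ j) (m+[n∸m]≡n c≤n))

sum-applyUpTo : ∀ m (F : ℕ → ℕ) → sum (applyUpTo F m) ≡ ∑< m F
sum-applyUpTo zero    F = refl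
sum-applyUpTo (suc m) F = cong (_+_ (F 0)) (sum-applyUpTo m (F ∘ suc))

sumFromTo-∑< : ∀ a b (f : ℕ → ℕ) → sumFromTo a b f ≡ ∑[ k < suc b ∸ a ] f (a + k)
sumFromTo-∑< a b f = trans (cong sum (map-upTo (λ k → f (a + k)) (suc b ∸ a))) (sum-applyUpTo (suc b ∸ a) (λ k → f (a + k)))

∑∈ : {A : Set} → List A → (A → ℕ) → ℕ
∑∈ xs f = sum (map f xs)

syntax ∑∈ xs (λ a → e) = ∑[ a ∈ xs ] e

module _ {A : Set} where

  ∑∈-cong : ∀ (xs : List A) {f g : A → ℕ} → (∀ a → f a ≡ g a) → ∑∈ xs f ≡ ∑∈ xs g
  ∑∈-cong xs eq = cong sum (map-cong eq xs)

  ∑∈-cong-All : ∀ {P : A → Set} {xs} {f g : A → ℕ} → All P xs → (∀ {a} → P a → f a ≡ g a) → ∑∈ xs f ≡ ∑∈ xs g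
  ∑∈-cong-All ps eq = cong sum (map-cong-local (All.map eq ps))

  ∑∈-zero : ∀ (xs : List A) {f : A → ℕ} → (∀ a → f a ≡ 0) → ∑∈ xs f ≡ 0
  ∑∈-zero []       eq = refl
  ∑∈-zero (x ∷ xs) eq rewrite eq x = ∑∈-zero xs eq

  ∑∈-+ : ∀ (xs : List A) (f g : A → ℕ) → ∑[ a ∈ xs ] (f a + g a) ≡ ∑∈ xs f + ∑∈ xs g
  ∑∈-+ []       f g = refl
  ∑∈-+ (x ∷ xs) f g = trans (cong (_+_ (f x + g x)) (∑∈-+ xs f g)) (interchange (f x) (g x) _ _)

  ∑∈-concatMap : ∀ (h : A → List A) xs (f : A → ℕ) → ∑∈ (concatMap h xs) f ≡ ∑[ x ∈ xs ] ∑∈ (h x) f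
  ∑∈-concatMap h []       f = refl
  ∑∈-concatMap h (x ∷ xs) f = begin
    sum (map f (h x ++ concatMap h xs))   ≡⟨ cong sum (map-++ f (h x) _) ⟩
    sum (map f (h x) ++ map f (concatMap h xs)) ≡⟨ sum-++ (map f (h x)) _ ⟩
    ∑∈ (h x) f + ∑∈ (concatMap h xs) f  ≡⟨ cong (_+_ (∑∈ (h x) f)) (∑∈-concatMap h xs f) ⟩
    ∑∈ (h x) f + ∑[ y ∈ xs ] ∑∈ (h y) f ∎
    where open ≡-Reasoning

  ∑∈-map : ∀ (h : A → A) xs (f : A → ℕ) → ∑∈ (map h xs) f ≡ ∑∈ xs (f ∘ h)
  ∑∈-map h xs f = cong sum (sym (map-∘ xs))

  ∑∈-filter : ∀ {P : A → Set} (P? : ∀ a → Dec (P a)) xs (f : A → ℕ) →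
    ∑∈ (filter P? xs) f ≡ ∑[ a ∈ xs ] (χ (P? a) * f a)
  ∑∈-filter P? []       f = refl
  ∑∈-filter P? (x ∷ xs) f with does (P? x)
  ... | false = ∑∈-filter P? xs f
  ... | true  = cong₂ _+_ (sym (+-identityʳ (f x))) (∑∈-filter P? xs f)

  length-filter-∑ : ∀ {P : A → Set} (P? : ∀ a → Dec (P a)) xs → length (filter P? xs) ≡ ∑[ a ∈ xs ] χ (P? a)
  length-filter-∑ P? []       = refl
  length-filter-∑ P? (x ∷ xs) with does (P? x)
  ... | false = length-filter-∑ P? xs
  ... | true  = cong suc (length-filter-∑ P? xs)

-- The value of rank x among ℕ ∖ {i}: the inverse of standardisation after deleting i.
punchIn : ℕ → ℕ → ℕ
punchIn i x with x <? i
... | yes _ = x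
... | no _  = suc x

punchIn-< : ∀ {i x} → x < i → punchIn i x ≡ x
punchIn-< {i} {x} x<i with x <? i
... | yes _   = refl
... | no x≮i  = ⊥-elim (x≮i x<i)

punchIn-≥ : ∀ {i x} → i ≤ x → punchIn i x ≡ suc x
punchIn-≥ {i} {x} i≤x with x <? i
... | yes x<i = ⊥-elim (≤⇒≯ i≤x x<i)
... | no _    = refl

punchIn-mono : ∀ {i x y} → x < y → punchIn i x < punchIn i y
punchIn-mono {i} {x} {y} x<y with x <? i | y <? i
... | yes _   | yes _   = x<y
... | yes _   | no _    = m<n⇒m<1+n x<y
... | no x≮i  | yes y<i = ⊥-elim (x≮i (<-trans x<y y<i))
... | no _    | no _    = s≤s x<y

punchIn-head : ∀ {i y} → i < punchIn i y ⇔ i ≤ y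
punchIn-head {i} {y} with y <? i
... | yes y<i = mk⇔ (λ i<y → ⊥-elim (<-asym i<y y<i)) (λ i≤y → ⊥-elim (<⇒≱ y<i i≤y))
... | no _    = mk⇔ (λ { (s≤s i≤y) → i≤y }) s≤s

map-punchIn-id : ∀ {n v} → All (_≤ n) v → map (punchIn (suc n)) v ≡ v
map-punchIn-id bounded = map-id-local (All.map (punchIn-< ∘ s≤s) bounded)

countAbove-∷ : ∀ y z v → countAbove y (z ∷ v) ≡ χ (y <? z) + countAbove y v
countAbove-∷ y z v with does (y <? z)
... | true  = refl
... | false = refl

countAbove-map : ∀ {h : ℕ → ℕ} {y′ y} → (∀ {z} → y′ < h z ⇔ y < z) → ∀ w → countAbove y′ (map h w) ≡ countAbove y w
countAbove-map             above []      = refl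
countAbove-map {h} {y′} {y} above (z ∷ w) = begin
  countAbove y′ (h z ∷ map h w)               ≡⟨ countAbove-∷ y′ (h z) (map h w) ⟩
  χ (y′ <? h z) + countAbove y′ (map h w)     ≡⟨ cong₂ _+_ (χ-⇔ above (y′ <? h z) (y <? z)) (countAbove-map above w) ⟩
  χ (y <? z) + countAbove y w                 ≡⟨ countAbove-∷ y z w ⟨
  countAbove y (z ∷ w)                        ∎
  where open ≡-Reasoning

module _ {h : ℕ → ℕ} (h-mono : ∀ {x y} → x < y → h x < h y) where

  mono-⇔ : ∀ {x y} → h x < h y ⇔ x < y
  mono-⇔ {x} {y} = mk⇔ reflects h-mono
    where
    reflects : h x < h y → x < y
    reflects hx<hy with <-cmp x y
    ... | tri< x<y _ _ = x<y
    ... | tri≈ _ refl _ = ⊥-elim (<-irrefl refl hx<hy)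
    ... | tri> _ _ y<x = ⊥-elim (<-asym hx<hy (h-mono y<x))

  occ123-map : ∀ w → occ123 (map h w) ≡ occ123 w
  occ123-map []           = refl
  occ123-map (x ∷ [])     = refl
  occ123-map (x ∷ y ∷ w) = cong₂ _+_
    (cong₂ (λ b m → if b then m else 0) (does-⇔ mono-⇔ (h x <? h y) (x <? y)) (countAbove-map mono-⇔ w))
    (occ123-map (y ∷ w))

occ123-∷-punchIn : ∀ i y w → occ123 (i ∷ map (punchIn i) (y ∷ w)) ≡ (if does (i ≤? y) then countAbove y w else 0) + occ123 (y ∷ w)
occ123-∷-punchIn i y w = cong₂ _+_
  (cong₂ (λ b m → if b then m else 0) (does-⇔ punchIn-head (i <? punchIn i y) (i ≤? y)) (countAbove-map (mono-⇔ punchIn-mono) w))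
  (occ123-map punchIn-mono (y ∷ w))

countAbove-punchIn : ∀ k v → countAbove (suc k) (map (punchIn (suc k)) v) ≡ countAbove k v
countAbove-punchIn k = countAbove-map punchIn-head

occ123-∷-max : ∀ {n} v → All (_≤ n) v → occ123 (suc n ∷ v) ≡ occ123 v
occ123-∷-max {n} []      []          = refl
occ123-∷-max {n} (y ∷ v) (y≤n ∷ _) rewrite dec-false (suc n <? y) (≤⇒≯ (m≤n⇒m≤1+n y≤n)) = refl

insertions-↭ : ∀ x a → All (_↭ x ∷ a) (insertions x a)
insertions-↭ x []      = ↭.refl ∷ []
insertions-↭ x (y ∷ a) =
  ↭.refl ∷ map⁺ (All.map (λ b↭ → ↭.trans (↭.prep y b↭) (↭.swap y x ↭.refl)) (insertions-↭ x a))

insertions-map : ∀ (h : ℕ → ℕ) x w → insertions (h x) (map h w) ≡ map (map h) (insertions x w)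
insertions-map h x []      = refl
insertions-map h x (y ∷ w) = cong (_∷_ (h x ∷ h y ∷ map h w)) (begin
  map (_∷_ (h y)) (insertions (h x) (map h w))   ≡⟨ cong (map (_∷_ (h y))) (insertions-map h x w) ⟩
  map (_∷_ (h y)) (map (map h) (insertions x w)) ≡⟨ map-∘ (insertions x w) ⟨
  map (map h ∘ _∷_ y) (insertions x w)           ≡⟨ map-∘ (insertions x w) ⟩
  map (map h) (map (_∷_ y) (insertions x w))     ∎)
  where open ≡-Reasoning

perms-↭ : ∀ n → All (_↭ applyDownFrom suc n) (perms n)
perms-↭ zero    = ↭.refl ∷ []
perms-↭ (suc n) = concat⁺ (map⁺ (All.map
  (λ {a} a↭ → All.map (λ b↭ → ↭.trans b↭ (↭.prep (suc n) a↭)) (insertions-↭ (suc n) a))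
  (perms-↭ n)))

perms-bounded : ∀ n → All (All (_≤ n)) (perms n)
perms-bounded n = All.map (λ a↭ → All-resp-↭ (↭-sym a↭) (applyDownFrom⁺₁ suc n (λ i<n → i<n))) (perms-↭ n)

countAbove-applyDownFrom : ∀ y n → countAbove y (applyDownFrom suc n) ≡ n ∸ y
countAbove-applyDownFrom y zero    = sym (0∸n≡0 y)
countAbove-applyDownFrom y (suc n) = begin
  countAbove y (suc n ∷ applyDownFrom suc n)              ≡⟨ countAbove-∷ y (suc n) _ ⟩
  χ (y <? suc n) + countAbove y (applyDownFrom suc n)     ≡⟨ cong (_+_ (χ (y <? suc n))) (countAbove-applyDownFrom y n) ⟩
  χ (y <? suc n) + (n ∸ y)                                ≡⟨ step (y ≤? n) ⟩
  suc n ∸ y                                               ∎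
  where
  open ≡-Reasoning
  step : Dec (y ≤ n) → χ (y <? suc n) + (n ∸ y) ≡ suc n ∸ y
  step (yes y≤n) rewrite χ-yes (y <? suc n) (s≤s y≤n) = sym (+-∸-assoc 1 y≤n)
  step (no y≰n)  rewrite χ-no (y <? suc n) (y≰n ∘ ≤-pred) =
    trans (m≤n⇒m∸n≡0 (<⇒≤ (≰⇒> y≰n))) (sym (m≤n⇒m∸n≡0 (≰⇒> y≰n)))

perms-countAbove : ∀ n → All (λ a → ∀ y → countAbove y a ≡ n ∸ y) (perms n)
perms-countAbove n = All.map (λ a↭ y → trans (↭-length (filter-↭ (y <?_) a↭)) (countAbove-applyDownFrom y n)) (perms-↭ n)

sum-insertions-after-head : ∀ {k m} (f : List ℕ → ℕ) → k < m → ∀ w →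
  ∑∈ (insertions (suc m) (suc k ∷ map (punchIn (suc k)) w)) f
    ≡ f (suc m ∷ suc k ∷ map (punchIn (suc k)) w) + ∑[ b ∈ insertions m w ] f (suc k ∷ map (punchIn (suc k)) b)
sum-insertions-after-head {k} {m} f k<m w = cong (_+_ (f (suc m ∷ suc k ∷ map ρ w))) (begin
  ∑∈ (map (_∷_ (suc k)) (insertions (suc m) (map ρ w))) f ≡⟨ ∑∈-map (_∷_ (suc k)) (insertions (suc m) (map ρ w)) f ⟩
  ∑[ b ∈ insertions (suc m) (map ρ w) ] f (suc k ∷ b)     ≡⟨ cong (λ bs → ∑[ b ∈ bs ] f (suc k ∷ b)) insert-max ⟩
  ∑[ b ∈ map (map ρ) (insertions m w) ] f (suc k ∷ b)     ≡⟨ ∑∈-map (map ρ) (insertions m w) (λ b → f (suc k ∷ b)) ⟩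
  ∑[ b ∈ insertions m w ] f (suc k ∷ map ρ b)             ∎)
  where
  open ≡-Reasoning
  ρ = punchIn (suc k)
  insert-max : insertions (suc m) (map ρ w) ≡ map (map ρ) (insertions m w)
  insert-max = trans (cong (λ x → insertions x (map ρ w)) (sym (punchIn-≥ k<m))) (insertions-map ρ m w)

-- A permutation of [n+2] is n+2 inserted into one of [n+1]: in front (giving head n+2) or
-- after the head, which is then kept.
sum-perms-suc : ∀ n (f : List ℕ → ℕ) →
  ∑[ a ∈ perms (suc n) ] f a ≡ ∑[ k < suc n ] ∑[ v ∈ perms n ] f (suc k ∷ map (punchIn (suc k)) v)
sum-perms-suc zero    f = sym (+-identityʳ _)
sum-perms-suc (suc n) f = begin
  ∑[ a ∈ perms (2 + n) ] f a
    ≡⟨ ∑∈-concatMap (insertions (2 + n)) (perms (suc n)) f ⟩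
  ∑[ v ∈ perms (suc n) ] ∑∈ (insertions (2 + n) v) f
    ≡⟨ sum-perms-suc n _ ⟩
  ∑[ k < suc n ] ∑[ w ∈ perms n ] ∑∈ (insertions (2 + n) (suc k ∷ map (punchIn (suc k)) w)) f
    ≡⟨ ∑<-cong (suc n) (λ k<m → ∑∈-cong (perms n) (sum-insertions-after-head f k<m)) ⟩
  ∑[ k < suc n ] ∑[ w ∈ perms n ] (Top k w + Rest k w)
    ≡⟨ ∑<-cong (suc n) (λ {k} _ → ∑∈-+ (perms n) (Top k) (Rest k)) ⟩
  ∑[ k < suc n ] (∑∈ (perms n) (Top k) + ∑∈ (perms n) (Rest k))
    ≡⟨ ∑<-+ (suc n) (λ k → ∑∈ (perms n) (Top k)) (λ k → ∑∈ (perms n) (Rest k)) ⟩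
  ∑[ k < suc n ] ∑∈ (perms n) (Top k) + ∑[ k < suc n ] ∑∈ (perms n) (Rest k)
    ≡⟨ cong₂ _+_ (sym (sum-perms-suc n (λ v → f (2 + n ∷ v))))
                 (∑<-cong (suc n) (λ {k} _ → sym (∑∈-concatMap (insertions (suc n)) (perms n) (X′ k)))) ⟩
  ∑[ v ∈ perms (suc n) ] f (2 + n ∷ v) + ∑< (suc n) X
    ≡⟨ cong (λ s → s + ∑< (suc n) X)
            (∑∈-cong-All (perms-bounded (suc n)) (λ bounded → cong (λ v → f (2 + n ∷ v)) (sym (map-punchIn-id bounded)))) ⟩
  X (suc n) + ∑< (suc n) X
    ≡⟨ +-comm (X (suc n)) _ ⟩
  ∑< (suc n) X + X (suc n)
    ≡⟨ ∑<-last (suc n) X ⟨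
  ∑< (2 + n) X ∎
  where
  open ≡-Reasoning
  X′ : ℕ → List ℕ → ℕ
  X′ k v = f (suc k ∷ map (punchIn (suc k)) v)
  X : ℕ → ℕ
  X k = ∑∈ (perms (suc n)) (X′ k)
  Top Rest : ℕ → List ℕ → ℕ
  Top k w  = f (2 + n ∷ suc k ∷ map (punchIn (suc k)) w)
  Rest k w = ∑[ b ∈ insertions (suc n) w ] X′ k b

-- Iverson bracket; it vanishes for negative z, matching u z n = 0 there.
[_≡_] : ℕ → ℤ → ℕ
[ o ≡ z ] = χ (+ o ℤ.≟ z)

[m+n≡z]≡[n≡z-m] : ∀ m n z → [ m + n ≡ z ] ≡ [ n ≡ z - + m ]
[m+n≡z]≡[n≡z-m] m n z = χ-⇔ (mk⇔ to from) (+ (m + n) ℤ.≟ z) (+ n ℤ.≟ z - + m)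
  where
  cancel : ∀ a b → b ≡ a ℤ.+ b - a
  cancel = solve-∀
  restore : ∀ a c → a ℤ.+ (c - a) ≡ c
  restore = solve-∀
  to : + (m + n) ≡ z → + n ≡ z - + m
  to e = trans (cancel (+ m) (+ n)) (cong (_- + m) e)
  from : + n ≡ z - + m → + (m + n) ≡ z
  from e = trans (cong (ℤ._+_ (+ m)) e) (restore (+ m) z)

head≟ : (a : List ℕ) (i : ℕ) → Dec (head a ≡ just i)
head≟ a i = maybe-≡-dec _≟_ (head a) (just i)

u-as-sum : ∀ z n → u z n ≡ ∑[ a ∈ perms n ] [ occ123 a ≡ z ]
u-as-sum (+ r)    n = length-filter-∑ (λ a → occ123 a ≟ r) (perms n)
u-as-sum -[1+ q ] n = sym (∑∈-zero (perms n) (λ _ → refl))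

u′-as-sum : ∀ z n i → u′ z n i ≡ ∑[ a ∈ perms n ] ([ occ123 a ≡ z ] * χ (head≟ a i))
u′-as-sum (+ r)    n i = trans (length-filter-∑ (λ a → head≟ a i) (filter (λ a → occ123 a ≟ r) (perms n)))
                               (∑∈-filter (λ a → occ123 a ≟ r) (perms n) (λ a → χ (head≟ a i)))
u′-as-sum -[1+ q ] n i = sym (∑∈-zero (perms n) (λ _ → refl))

sum-perms-head : ∀ n {c} (f : List ℕ → ℕ) → c < suc n →
  ∑[ a ∈ perms (suc n) ] (f a * χ (head≟ a (suc c))) ≡ ∑[ v ∈ perms n ] f (suc c ∷ map (punchIn (suc c)) v)
sum-perms-head n {c} f c<1+n = begin
  ∑[ a ∈ perms (suc n) ] (f a * χ (head≟ a (suc c)))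
    ≡⟨ sum-perms-suc n _ ⟩
  ∑[ k < suc n ] ∑[ v ∈ perms n ] (f (entry k v) * χ (head≟ (entry k v) (suc c)))
    ≡⟨ ∑<-single (suc n) c<1+n (λ _ k≢c → ∑∈-zero (perms n) (λ v → other k≢c v)) ⟩
  ∑[ v ∈ perms n ] (f (entry c v) * χ (head≟ (entry c v) (suc c)))
    ≡⟨ ∑∈-cong (perms n) (λ v → trans (cong (_*_ (f (entry c v))) (χ-yes (head≟ (entry c v) (suc c)) refl)) (*-identityʳ _)) ⟩
  ∑[ v ∈ perms n ] f (entry c v) ∎
  where
  open ≡-Reasoning
  entry : ℕ → List ℕ → List ℕ
  entry k v = suc k ∷ map (punchIn (suc k)) v
  other : ∀ {k} → k ≢ c → ∀ v → f (entry k v) * χ (head≟ (entry k v) (suc c)) ≡ 0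
  other {k} k≢c v =
    trans (cong (_*_ (f (entry k v))) (χ-no (head≟ (entry k v) (suc c)) (k≢c ∘ suc-injective ∘ just-injective)))
          (*-zeroʳ (f (entry k v)))

u′-first-entry : ∀ z {n c} → c < suc n →
  u′ z (suc n) (suc c) ≡ ∑[ v ∈ perms n ] [ occ123 (suc c ∷ map (punchIn (suc c)) v) ≡ z ]
u′-first-entry z {n} c<1+n = trans (u′-as-sum z (suc n) _) (sum-perms-head n (λ a → [ occ123 a ≡ z ]) c<1+n)

u-by-first-entry : ∀ z n → u z (suc n) ≡ ∑[ k < suc n ] u′ z (suc n) (suc k)
u-by-first-entry z n = trans (u-as-sum z (suc n))
  (trans (sum-perms-suc n _) (∑<-cong (suc n) (λ k<1+n → sym (u′-first-entry z k<1+n))))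

u′-first-max : ∀ z n → u′ z (suc n) (suc n) ≡ u z n
u′-first-max z n = begin
  u′ z (suc n) (suc n)                                           ≡⟨ u′-first-entry z ≤-refl ⟩
  ∑[ v ∈ perms n ] [ occ123 (suc n ∷ map (punchIn (suc n)) v) ≡ z ] ≡⟨ ∑∈-cong-All (perms-bounded n) drop-max ⟩
  ∑[ v ∈ perms n ] [ occ123 v ≡ z ]                               ≡⟨ u-as-sum z n ⟨
  u z n                                                          ∎
  where
  open ≡-Reasoning
  drop-max : ∀ {v} → All (_≤ n) v → [ occ123 (suc n ∷ map (punchIn (suc n)) v) ≡ z ] ≡ [ occ123 v ≡ z ]
  drop-max {v} bounded rewrite map-punchIn-id bounded = cong [_≡ z ] (occ123-∷-max v bounded)

-- The first two entries c+1 and punchIn (c+1) (k+1) of a permutation of [n+2] form a 12 exactly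
-- when c ≤ k, and then each of the n ∸ k later entries above k+2 completes it to a 12-3.
leadingOcc : ℕ → ℕ → ℕ → ℕ
leadingOcc n c k = if does (suc c ≤? suc k) then n ∸ k else 0

leadingOcc-< : ∀ n {c k} → k < c → leadingOcc n c k ≡ 0
leadingOcc-< n {c} {k} k<c = cong (λ b → if b then n ∸ k else 0) (dec-false (suc c ≤? suc k) (<⇒≱ k<c ∘ ≤-pred))

leadingOcc-≥ : ∀ n {c k} → c ≤ k → leadingOcc n c k ≡ n ∸ k
leadingOcc-≥ n {c} {k} c≤k = cong (λ b → if b then n ∸ k else 0) (dec-true (suc c ≤? suc k) (s≤s c≤k))

u′-by-second-entry : ∀ z n {c} → c < 2 + n →
  u′ z (2 + n) (suc c) ≡ ∑[ k < suc n ] u′ (z - + leadingOcc n c k) (suc n) (suc k)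
u′-by-second-entry z n {c} c<2+n = begin
  u′ z (2 + n) (suc c)
    ≡⟨ u′-first-entry z c<2+n ⟩
  ∑[ w ∈ perms (suc n) ] [ occ123 (suc c ∷ map ρ w) ≡ z ]
    ≡⟨ sum-perms-suc n (λ w → [ occ123 (suc c ∷ map ρ w) ≡ z ]) ⟩
  ∑[ k < suc n ] ∑[ v ∈ perms n ] [ occ123 (suc c ∷ map ρ (suc k ∷ map (punchIn (suc k)) v)) ≡ z ]
    ≡⟨ ∑<-cong (suc n) (λ {k} _ → ∑∈-cong-All (perms-countAbove n) (λ {v} → shift k {v})) ⟩
  ∑[ k < suc n ] ∑[ v ∈ perms n ] [ occ123 (suc k ∷ map (punchIn (suc k)) v) ≡ z - + leadingOcc n c k ]
    ≡⟨ ∑<-cong (suc n) (λ {k} k<1+n → sym (u′-first-entry (z - + leadingOcc n c k) k<1+n)) ⟩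
  ∑[ k < suc n ] u′ (z - + leadingOcc n c k) (suc n) (suc k) ∎
  where
  open ≡-Reasoning
  ρ = punchIn (suc c)
  shift : ∀ k {v} → (∀ y → countAbove y v ≡ n ∸ y) →
    [ occ123 (suc c ∷ map ρ (suc k ∷ map (punchIn (suc k)) v)) ≡ z ]
      ≡ [ occ123 (suc k ∷ map (punchIn (suc k)) v) ≡ z - + leadingOcc n c k ]
  shift k {v} count = trans (cong [_≡ z ] (begin
    occ123 (suc c ∷ map ρ (suc k ∷ map (punchIn (suc k)) v))
      ≡⟨ occ123-∷-punchIn (suc c) (suc k) (map (punchIn (suc k)) v) ⟩
    (if does (suc c ≤? suc k) then countAbove (suc k) (map (punchIn (suc k)) v) else 0) + occ123 (suc k ∷ map (punchIn (suc k)) v)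
      ≡⟨ cong (λ m → (if does (suc c ≤? suc k) then m else 0) + occ123 (suc k ∷ map (punchIn (suc k)) v))
              (trans (countAbove-punchIn k v) (count k)) ⟩
    leadingOcc n c k + occ123 (suc k ∷ map (punchIn (suc k)) v) ∎))
    ([m+n≡z]≡[n≡z-m] (leadingOcc n c k) _ z)

u′-first-submax : ∀ z n → u′ z (2 + n) (suc n) ≡ u z (suc n)
u′-first-submax z n = begin
  u′ z (2 + n) (suc n)                                   ≡⟨ u′-by-second-entry z n (m<n⇒m<1+n (n<1+n n)) ⟩
  ∑[ k < suc n ] u′ (z - + leadingOcc n n k) (suc n) (suc k)
    ≡⟨ ∑<-cong (suc n) (λ {k} _ → cong (λ e → u′ (z - + e) (suc n) (suc k)) (no-leadingOcc k)) ⟩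
  ∑[ k < suc n ] u′ (z - + 0) (suc n) (suc k)
    ≡⟨ ∑<-cong (suc n) (λ {k} _ → cong (λ w → u′ w (suc n) (suc k)) (ℤₚ.+-identityʳ z)) ⟩
  ∑[ k < suc n ] u′ z (suc n) (suc k)                    ≡⟨ u-by-first-entry z n ⟨
  u z (suc n)                                            ∎
  where
  open ≡-Reasoning
  no-leadingOcc : ∀ k → leadingOcc n n k ≡ 0
  no-leadingOcc k with k <? n
  ... | yes k<n = leadingOcc-< n k<n
  ... | no k≮n  = trans (leadingOcc-≥ n (≮⇒≥ k≮n)) (m≤n⇒m∸n≡0 (≮⇒≥ k≮n))

u′-first-interior : ∀ z n {c} → c < n →
  u′ z (2 + n) (suc c) ≡ ∑[ k < c ] u′ z (suc n) (suc k) + ∑[ j < suc (n ∸ c) ] u′ (z - + j) (suc n) (suc n ∸ j)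
u′-first-interior z n {c} c<n = begin
  u′ z (2 + n) (suc c)
    ≡⟨ u′-by-second-entry z n (m<n⇒m<1+n (m<n⇒m<1+n c<n)) ⟩
  ∑< (suc n) G
    ≡⟨ ∑<-split-top G c≤n ⟩
  ∑< c G + ∑[ j < suc (n ∸ c) ] G (n ∸ j)
    ≡⟨ cong₂ _+_ (∑<-cong c below) (∑<-cong (suc (n ∸ c)) above) ⟩
  ∑[ k < c ] u′ z (suc n) (suc k) + ∑[ j < suc (n ∸ c) ] u′ (z - + j) (suc n) (suc n ∸ j) ∎
  where
  open ≡-Reasoning
  c≤n = <⇒≤ c<n
  G : ℕ → ℕ
  G k = u′ (z - + leadingOcc n c k) (suc n) (suc k)
  below : ∀ {k} → k < c → G k ≡ u′ z (suc n) (suc k)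
  below {k} k<c = trans (cong (λ e → u′ (z - + e) (suc n) (suc k)) (leadingOcc-< n k<c))
                        (cong (λ w → u′ w (suc n) (suc k)) (ℤₚ.+-identityʳ z))
  above : ∀ {j} → j < suc (n ∸ c) → G (n ∸ j) ≡ u′ (z - + j) (suc n) (suc n ∸ j)
  above {j} (s≤s j≤n∸c) = begin
    G (n ∸ j)                                       ≡⟨ cong (λ e → u′ (z - + e) (suc n) (suc (n ∸ j))) (leadingOcc-≥ n c≤n∸j) ⟩
    u′ (z - + (n ∸ (n ∸ j))) (suc n) (suc (n ∸ j))  ≡⟨ cong₂ (λ e i → u′ (z - + e) (suc n) i) (m∸[m∸n]≡n j≤n) (sym (+-∸-assoc 1 j≤n)) ⟩
    u′ (z - + j) (suc n) (suc n ∸ j)                 ∎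
    where
    j≤n = ≤-trans j≤n∸c (m∸n≤m n c)
    c≤n∸j = subst (_≤ n ∸ j) (m∸[m∸n]≡n c≤n) (∸-monoʳ-≤ n j≤n∸c)

lemma2 : (r : ℤ) (n : ℕ) → n ≥ 1 →
    (u′ r n n ≡ u r (n ∸ 1))
    × (n ≥ 2 → u′ r n (n ∸ 1) ≡ u r (n ∸ 1))
    × ((i : ℕ) → 1 ≤ i → i ≤ n ∸ 2 →
        u′ r n i ≡ sumFromTo 1 (i ∸ 1) (λ j → u′ r (n ∸ 1) j)
                   + sumFromTo 0 (n ∸ i ∸ 1) (λ j → u′ (r - + j) (n ∸ 1) (n ∸ 1 ∸ j)))
lemma2 r (suc m) _ = u′-first-max r m , submax m , interior m
  where
  submax : ∀ m → suc m ≥ 2 → u′ r (suc m) m ≡ u r m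
  submax zero    (s≤s ())
  submax (suc n) _ = u′-first-submax r n
  interior : ∀ m (i : ℕ) → 1 ≤ i → i ≤ suc m ∸ 2 →
    u′ r (suc m) i ≡ sumFromTo 1 (i ∸ 1) (λ j → u′ r m j) + sumFromTo 0 (suc m ∸ i ∸ 1) (λ j → u′ (r - + j) m (m ∸ j))
  interior zero    (suc c) _ ()
  interior (suc n) (suc c) _ c<n = begin
    u′ r (2 + n) (suc c)
      ≡⟨ u′-first-interior r n c<n ⟩
    ∑[ k < c ] u′ r (suc n) (suc k) + ∑[ j < suc (n ∸ c) ] u′ (r - + j) (suc n) (suc n ∸ j)
      ≡⟨ cong (λ l → ∑[ k < c ] u′ r (suc n) (suc k) + ∑[ j < suc l ] u′ (r - + j) (suc n) (suc n ∸ j))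
              (cong (_∸ 1) (+-∸-assoc 1 (<⇒≤ c<n))) ⟨
    ∑[ k < c ] u′ r (suc n) (suc k) + ∑[ j < suc (suc n ∸ c ∸ 1) ] u′ (r - + j) (suc n) (suc n ∸ j)
      ≡⟨ cong₂ _+_ (sumFromTo-∑< 1 c (u′ r (suc n))) (sumFromTo-∑< 0 (suc n ∸ c ∸ 1) _) ⟨
    sumFromTo 1 c (u′ r (suc n)) + sumFromTo 0 (suc n ∸ c ∸ 1) (λ j → u′ (r - + j) (suc n) (suc n ∸ j)) ∎
    where open ≡-Reasoning
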